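{- For every integer $k\ge0$, as polynomials in $m$, \[ \binom{m+k}{2k}=\frac{\prod_{r=0}^{k-1}\bigl(m(m+1)-r(r+1)\bigr)}{(2k)!}=\frac{(m+k)^{\underline{2k}}}{(2k)!}=\frac1{(2k)!}\sum_{r=0}^kPs_k^{(r)}(m(m+1))^r, \] and for every integer $k\ge1$, \[ \binom{m+k-1}{2k-1}=\frac{m\prod_{t=1}^{k-1}(m^2-t^2)}{(2k-1)!}=\frac{(m+k-1)^{\underline{2k-1}}}{(2k-1)!}=\frac1{(2k-1)!}\sum_{r=1}^k\mathcal{S}_k^{(r)}m^{2r-1}. \]
   Context: $x^{\underline j}=x(x-1)\cdots(x-j+1)$. $Ps_k^{(r)}$ (Legendre–Stirling numbers of the first kind) are defined by $\prod_{i=0}^{k-1}(y-i(i+1))=\sum_{r=0}^kPs_k^{(r)}y^r$, and $\mathcal{S}_k^{(r)}=\sum_{i=0}^k\binom{i}{2i-2r}Ps_k^{(i)}$ (binomial coefficients with negative or too large lower index are $0$). -}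

module Defs where

open import Data.Nat as ℕ using (ℕ; zero; suc; _∸_; _≤ᵇ_)
open import Data.Nat.Combinatorics using (_C_)
open import Data.Integer using (ℤ; +_; _+_; _-_; _*_; -_)
open import Data.List using (List; []; _∷_)
open import Data.Bool using (if_then_else_)

sumℤ : ℕ → (ℕ → ℤ) → ℤ
sumℤ zero    f = + 0
sumℤ (suc n) f = sumℤ n f + f n

prodℤ : ℕ → (ℕ → ℤ) → ℤ
prodℤ zero    f = + 1
prodℤ (suc n) f = prodℤ n f * f n

falling : ℤ → ℕ → ℤ
falling x j = prodℤ j (λ i → x - + i)

-- Polynomials in y with integer coefficients, lowest degree first.
Poly : Set
Poly = List ℤ

coeff : Poly → ℕ → ℤ
coeff []       _       = + 0
coeff (a ∷ p)  zero    = a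
coeff (a ∷ p)  (suc r) = coeff p r

scale : ℤ → Poly → Poly
scale c []      = []
scale c (a ∷ p) = c * a ∷ scale c p

addP : Poly → Poly → Poly
addP []      q       = q
addP p       []      = p
addP (a ∷ p) (b ∷ q) = a + b ∷ addP p q

mulLin : ℤ → Poly → Poly
mulLin c p = addP (+ 0 ∷ p) (scale (- c) p)

psPoly : ℕ → Poly
psPoly zero    = + 1 ∷ []
psPoly (suc k) = mulLin (+ (k ℕ.* suc k)) (psPoly k)

Ps : ℕ → ℕ → ℤ
Ps k r = coeff (psPoly k) r

-- binomial coefficient binom(i, 2i - 2r) with lower index an integer:
-- zero when 2i-2r < 0 (i.e. i < r) and, via stdlib _C_, when it exceeds i.
binomLow : ℕ → ℕ → ℤ
binomLow i r = if r ≤ᵇ i then + (i C (2 ℕ.* (i ∸ r))) else + 0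

𝒮 : ℕ → ℕ → ℤ
𝒮 k r = sumℤ (suc k) (λ i → binomLow i r * Ps k i)

-- Both product forms are falling factorials: multiplying a falling factorial by
-- (x + k + 1)(x - k) = x(x + 1) - k(k + 1), resp. (x + k + 1)(x - k - 1) = x² - (k + 1)², extends it
-- by two factors, and j! C(n, j) = n^{\underline j} gives the binomial forms.
--
-- For 𝒮, exchanging the two sums gives ∑_r 𝒮_k^(r) x^{2r} = ∑_i Ps_k^(i) E_i(x), where
-- E_i(x) = ∑_r C(i, 2i - 2r) x^{2r} is the even part of (x² + x)^i. Pascal's rule, valid for every
-- integer lower index, propagates E_i together with the odd part and yields
-- 2 E_i(x) = (x(x + 1))^i + (x(x - 1))^i, so twice the sum is P(x(x + 1)) + P(x(x - 1)) with
-- P(y) = ∏_{r<k} (y - r(r + 1)). For k ≥ 1 this is (x + k) Q(x) + (k - x) Q(-x) = 2x Q(x), where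
-- Q(x) = x ∏_{t=1}^{k-1} (x² - t²) is odd. Since the sum is also 𝒮_k^(0) + x ∑_r 𝒮_k^(r) x^{2r-1},
-- evaluating at x = 0 gives 𝒮_k^(0) = 0, and cancelling x gives the last identity.

module Submission where

open import Defs
open import Data.Nat using (ℕ; suc; _∸_; _≤_; _!)
open import Data.Nat.Combinatorics using (_C_)
open import Data.Integer using (ℤ; +_; _+_; _-_; _*_; _^_)
open import Data.Product using (_×_)
open import Relation.Binary.PropositionalEquality using (_≡_)

import Data.Nat as ℕ
open Data.Nat using (zero; _<_; _≤ᵇ_; s≤s; z<s)
import Data.Nat.Properties as ℕP
open import Data.Nat.Combinatorics using (nCk+nC[k+1]≡[n+1]C[k+1]; k>n⇒nCk≡0)
open import Data.Integer using (-_; -[1+_]; +[1+_])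
import Data.Integer.Properties as ℤP
open import Data.Integer.Tactic.RingSolver using (solve-∀)
open import Data.Bool using (true; false)
open import Data.List using ([]; _∷_; length)
open import Data.Product using (_,_)
open import Function using (_∘_)
open import Algebra.Properties.CommutativeSemigroup ℤP.*-commutativeSemigroup using () renaming (x∙yz≈y∙xz to *-left-comm)
open import Relation.Nullary.Reflects using (ofʸ; ofⁿ)
open import Relation.Nullary.Negation using (contradiction)
open import Relation.Binary.PropositionalEquality using (refl; sym; trans; cong; cong₂; module ≡-Reasoning)
open ≡-Reasoning

sumℤ-cong : ∀ n {f g : ℕ → ℤ} → (∀ i → i < n → f i ≡ g i) → sumℤ n f ≡ sumℤ n g
sumℤ-cong zero    f≡g = refl
sumℤ-cong (suc n) f≡g = cong₂ _+_ (sumℤ-cong n (λ i i<n → f≡g i (ℕP.m<n⇒m<1+n i<n))) (f≡g n ℕP.≤-refl)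

sumℤ-zero : ∀ n {f : ℕ → ℤ} → (∀ i → i < n → f i ≡ + 0) → sumℤ n f ≡ + 0
sumℤ-zero zero    f≡0 = refl
sumℤ-zero (suc n) f≡0 = cong₂ _+_ (sumℤ-zero n (λ i i<n → f≡0 i (ℕP.m<n⇒m<1+n i<n))) (f≡0 n ℕP.≤-refl)

sumℤ-head : ∀ n (f : ℕ → ℤ) → sumℤ (suc n) f ≡ f 0 + sumℤ n (λ i → f (suc i))
sumℤ-head zero    f = trans (ℤP.+-identityˡ (f 0)) (sym (ℤP.+-identityʳ (f 0)))
sumℤ-head (suc n) f = trans (cong (_+ f (suc n)) (sumℤ-head n f)) (ℤP.+-assoc (f 0) _ _)

sumℤ-distrib-+ : ∀ n (f g : ℕ → ℤ) → sumℤ n (λ i → f i + g i) ≡ sumℤ n f + sumℤ n g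
sumℤ-distrib-+ zero    f g = refl
sumℤ-distrib-+ (suc n) f g =
  trans (cong (_+ (f n + g n)) (sumℤ-distrib-+ n f g)) (interchange (sumℤ n f) (sumℤ n g) (f n) (g n))
  where
  interchange : ∀ a b c d → a + b + (c + d) ≡ a + c + (b + d)
  interchange = solve-∀

*-distribˡ-sumℤ : ∀ n c (f : ℕ → ℤ) → c * sumℤ n f ≡ sumℤ n (λ i → c * f i)
*-distribˡ-sumℤ zero    c f = ℤP.*-zeroʳ c
*-distribˡ-sumℤ (suc n) c f =
  trans (ℤP.*-distribˡ-+ c (sumℤ n f) (f n)) (cong (_+ c * f n) (*-distribˡ-sumℤ n c f))

*-distribʳ-sumℤ : ∀ n c (f : ℕ → ℤ) → sumℤ n f * c ≡ sumℤ n (λ i → f i * c)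
*-distribʳ-sumℤ zero    c f = refl
*-distribʳ-sumℤ (suc n) c f =
  trans (ℤP.*-distribʳ-+ c (sumℤ n f) (f n)) (cong (_+ f n * c) (*-distribʳ-sumℤ n c f))

sumℤ-linear : ∀ n a b (f g : ℕ → ℤ) → sumℤ n (λ i → a * f i + b * g i) ≡ a * sumℤ n f + b * sumℤ n g
sumℤ-linear n a b f g =
  trans (sumℤ-distrib-+ n _ _) (sym (cong₂ _+_ (*-distribˡ-sumℤ n a f) (*-distribˡ-sumℤ n b g)))

sumℤ-comm : ∀ m n (f : ℕ → ℕ → ℤ) →
            sumℤ m (λ r → sumℤ n (f r)) ≡ sumℤ n (λ i → sumℤ m (λ r → f r i))
sumℤ-comm zero    n f = sym (sumℤ-zero n (λ _ _ → refl))
sumℤ-comm (suc m) n f =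
  trans (cong (_+ sumℤ n (f m)) (sumℤ-comm m n f)) (sym (sumℤ-distrib-+ n _ (f m)))

prodℤ-cong : ∀ n {f g : ℕ → ℤ} → (∀ i → f i ≡ g i) → prodℤ n f ≡ prodℤ n g
prodℤ-cong zero    f≡g = refl
prodℤ-cong (suc n) f≡g = cong₂ _*_ (prodℤ-cong n f≡g) (f≡g n)

prodℤ-head : ∀ n (f : ℕ → ℤ) → prodℤ (suc n) f ≡ f 0 * prodℤ n (λ i → f (suc i))
prodℤ-head zero    f = trans (ℤP.*-identityˡ (f 0)) (sym (ℤP.*-identityʳ (f 0)))
prodℤ-head (suc n) f = trans (cong (_* f (suc n)) (prodℤ-head n f)) (ℤP.*-assoc (f 0) _ _)

pos-pascal : ∀ n k → + (suc n C suc k) ≡ + (n C k) + + (n C suc k)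
pos-pascal n k = trans (cong +_ (sym (nCk+nC[k+1]≡[n+1]C[k+1] n k))) (ℤP.pos-+ (n C k) (n C suc k))

2*[1+n]∸1≡1+2*n : ∀ n → 2 ℕ.* suc n ∸ 1 ≡ suc (2 ℕ.* n)
2*[1+n]∸1≡1+2*n n = cong (_∸ 1) (ℕP.*-suc 2 n)

falling-suc : ∀ x j → falling (+ 1 + x) (suc j) ≡ (+ 1 + x) * falling x j
falling-suc x j = begin
  prodℤ (suc j) (λ i → + 1 + x - + i)                  ≡⟨ prodℤ-head j _ ⟩
  (+ 1 + x - + 0) * prodℤ j (λ i → + 1 + x - + suc i) ≡⟨ cong₂ _*_ (top x) (prodℤ-cong j (λ i → shift x (+ i))) ⟩
  (+ 1 + x) * falling x j                               ∎
  where
  top : ∀ x → + 1 + x - + 0 ≡ + 1 + x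
  top = solve-∀
  shift : ∀ x i → + 1 + x - (+ 1 + i) ≡ x - i
  shift = solve-∀

!*C≡falling : ∀ n j → + (j !) * + (n C j) ≡ falling (+ n) j
!*C≡falling n       zero    = refl
!*C≡falling zero    (suc j) = trans (ℤP.*-zeroʳ (+ (suc j !))) (sym (prodℤ-head j _))
!*C≡falling (suc n) (suc j) = begin
  + (suc j !) * + (suc n C suc j)
    ≡⟨ trans (cong (+ (suc j !) *_) (pos-pascal n j)) (ℤP.*-distribˡ-+ (+ (suc j !)) _ _) ⟩
  + (suc j !) * + (n C j) + + (suc j !) * + (n C suc j)
    ≡⟨ cong₂ _+_ (trans (cong (_* + (n C j)) (ℤP.pos-* (suc j) (j !))) (ℤP.*-assoc (+ suc j) (+ (j !)) (+ (n C j))))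
                 (!*C≡falling n (suc j)) ⟩
  + suc j * (+ (j !) * + (n C j)) + falling (+ n) (suc j)
    ≡⟨ cong (λ z → + suc j * z + falling (+ n) (suc j)) (!*C≡falling n j) ⟩
  + suc j * falling (+ n) j + falling (+ n) j * (+ n - + j)
    ≡⟨ collect (+ n) (+ j) (falling (+ n) j) ⟩
  (+ 1 + + n) * falling (+ n) j
    ≡⟨ falling-suc (+ n) j ⟨
  falling (+ suc n) (suc j)
    ∎
  where
  collect : ∀ n j F → (+ 1 + j) * F + F * (n - j) ≡ (+ 1 + n) * F
  collect = solve-∀

falling-+suc : ∀ x k j → falling (x + + suc k) (suc (suc j)) ≡ falling (x + + k) j * ((x + + suc k) * (x + + k - + j))
falling-+suc x k j = begin
  falling (x + + suc k) (suc (suc j))                        ≡⟨ cong (λ y → falling y (suc (suc j))) (shift x (+ k)) ⟩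
  falling (+ 1 + (x + + k)) (suc (suc j))                    ≡⟨ falling-suc (x + + k) (suc j) ⟩
  (+ 1 + (x + + k)) * (falling (x + + k) j * (x + + k - + j)) ≡⟨ rearrange x (+ k) (falling (x + + k) j) (x + + k - + j) ⟩
  falling (x + + k) j * ((x + + suc k) * (x + + k - + j))    ∎
  where
  shift : ∀ x k → x + (+ 1 + k) ≡ + 1 + (x + k)
  shift = solve-∀
  rearrange : ∀ x k F d → (+ 1 + (x + k)) * (F * d) ≡ F * ((x + (+ 1 + k)) * d)
  rearrange = solve-∀

evenProd : ℕ → ℤ → ℤ
evenProd k x = prodℤ k (λ r → x * (x + + 1) - + r * (+ r + + 1))

-- x ∏_{t=1}^{k} (x² - t²): the paper's product for k + 1.
oddProd : ℕ → ℤ → ℤ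
oddProd k x = x * prodℤ k (λ t → x * x - + suc t * + suc t)

evenProd≡falling : ∀ k x → evenProd k x ≡ falling (x + + k) (2 ℕ.* k)
evenProd≡falling zero    x = refl
evenProd≡falling (suc k) x = begin
  evenProd k x * (x * (x + + 1) - + k * (+ k + + 1))
    ≡⟨ cong₂ _*_ (evenProd≡falling k x) factor ⟩
  falling (x + + k) (2 ℕ.* k) * ((x + + suc k) * (x + + k - + (2 ℕ.* k)))
    ≡⟨ falling-+suc x k (2 ℕ.* k) ⟨
  falling (x + + suc k) (suc (suc (2 ℕ.* k)))
    ≡⟨ cong (falling (x + + suc k)) (ℕP.*-suc 2 k) ⟨
  falling (x + + suc k) (2 ℕ.* suc k)
    ∎
  where
  factorℤ : ∀ x k → x * (x + + 1) - k * (k + + 1) ≡ (x + (+ 1 + k)) * (x + k - + 2 * k)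
  factorℤ = solve-∀
  factor : x * (x + + 1) - + k * (+ k + + 1) ≡ (x + + suc k) * (x + + k - + (2 ℕ.* k))
  factor = trans (factorℤ x (+ k)) (cong (λ z → (x + + suc k) * (x + + k - z)) (sym (ℤP.pos-* 2 k)))

oddProd≡falling : ∀ k x → oddProd k x ≡ falling (x + + k) (suc (2 ℕ.* k))
oddProd≡falling zero    x = base x
  where
  base : ∀ x → x * + 1 ≡ + 1 * (x + + 0 - + 0)
  base = solve-∀
oddProd≡falling (suc k) x = begin
  x * (prodℤ k g * (x * x - + suc k * + suc k))
    ≡⟨ ℤP.*-assoc x (prodℤ k g) _ ⟨
  oddProd k x * (x * x - + suc k * + suc k)
    ≡⟨ cong₂ _*_ (oddProd≡falling k x) factor ⟩
  falling (x + + k) (suc (2 ℕ.* k)) * ((x + + suc k) * (x + + k - + suc (2 ℕ.* k)))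
    ≡⟨ falling-+suc x k (suc (2 ℕ.* k)) ⟨
  falling (x + + suc k) (suc (suc (suc (2 ℕ.* k))))
    ≡⟨ cong (falling (x + + suc k) ∘ suc) (ℕP.*-suc 2 k) ⟨
  falling (x + + suc k) (suc (2 ℕ.* suc k))
    ∎
  where
  g : ℕ → ℤ
  g t = x * x - + suc t * + suc t
  factorℤ : ∀ x k → x * x - (+ 1 + k) * (+ 1 + k) ≡ (x + (+ 1 + k)) * (x + k - (+ 1 + + 2 * k))
  factorℤ = solve-∀
  factor : x * x - + suc k * + suc k ≡ (x + + suc k) * (x + + k - + suc (2 ℕ.* k))
  factor = trans (factorℤ x (+ k)) (cong (λ z → (x + + suc k) * (x + + k - (+ 1 + z))) (sym (ℤP.pos-* 2 k)))

!*C≡evenProd : ∀ k m → + ((2 ℕ.* k) !) * + ((m ℕ.+ k) C (2 ℕ.* k)) ≡ evenProd k (+ m)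
!*C≡evenProd k m = begin
  + ((2 ℕ.* k) !) * + ((m ℕ.+ k) C (2 ℕ.* k)) ≡⟨ !*C≡falling (m ℕ.+ k) (2 ℕ.* k) ⟩
  falling (+ (m ℕ.+ k)) (2 ℕ.* k)              ≡⟨ cong (λ y → falling y (2 ℕ.* k)) (ℤP.pos-+ m k) ⟩
  falling (+ m + + k) (2 ℕ.* k)                ≡⟨ evenProd≡falling k (+ m) ⟨
  evenProd k (+ m)                             ∎

!*C≡oddProd : ∀ k m → + ((2 ℕ.* suc k ∸ 1) !) * + ((m ℕ.+ suc k ∸ 1) C (2 ℕ.* suc k ∸ 1)) ≡ oddProd k (+ m)
!*C≡oddProd k m = begin
  + ((2 ℕ.* suc k ∸ 1) !) * + ((m ℕ.+ suc k ∸ 1) C (2 ℕ.* suc k ∸ 1))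
    ≡⟨ cong₂ (λ n j → + (j !) * + (n C j)) (cong (_∸ 1) (ℕP.+-suc m k)) (2*[1+n]∸1≡1+2*n k) ⟩
  + (suc (2 ℕ.* k) !) * + ((m ℕ.+ k) C suc (2 ℕ.* k))
    ≡⟨ !*C≡falling (m ℕ.+ k) (suc (2 ℕ.* k)) ⟩
  falling (+ (m ℕ.+ k)) (suc (2 ℕ.* k))
    ≡⟨ cong (λ y → falling y (suc (2 ℕ.* k))) (ℤP.pos-+ m k) ⟩
  falling (+ m + + k) (suc (2 ℕ.* k))
    ≡⟨ oddProd≡falling k (+ m) ⟨
  oddProd k (+ m)
    ∎

evenProd-suc : ∀ k x → evenProd (suc k) x ≡ (x + + suc k) * oddProd k x
evenProd-suc zero    x = base x
  where
  base : ∀ x → + 1 * (x * (x + + 1) - + 0 * (+ 0 + + 1)) ≡ (x + + 1) * (x * + 1)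
  base = solve-∀
evenProd-suc (suc k) x = begin
  evenProd (suc k) x * (x * (x + + 1) - + suc k * (+ suc k + + 1))
    ≡⟨ cong (_* (x * (x + + 1) - + suc k * (+ suc k + + 1))) (evenProd-suc k x) ⟩
  (x + + suc k) * (x * p) * (x * (x + + 1) - + suc k * (+ suc k + + 1))
    ≡⟨ step x (+ k) p ⟩
  (x + + suc (suc k)) * (x * (p * (x * x - + suc k * + suc k)))
    ∎
  where
  p : ℤ
  p = prodℤ k (λ t → x * x - + suc t * + suc t)
  step : ∀ x k p → (x + (+ 1 + k)) * (x * p) * (x * (x + + 1) - (+ 1 + k) * ((+ 1 + k) + + 1))
                   ≡ (x + (+ 1 + (+ 1 + k))) * (x * (p * (x * x - (+ 1 + k) * (+ 1 + k))))
  step = solve-∀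

oddProd-neg : ∀ k x → oddProd k (- x) ≡ - oddProd k x
oddProd-neg k x = begin
  - x * prodℤ k (λ t → - x * - x - + suc t * + suc t)
    ≡⟨ cong (- x *_) (prodℤ-cong k (λ t → cong (_- + suc t * + suc t) (neg-square x))) ⟩
  - x * prodℤ k (λ t → x * x - + suc t * + suc t)
    ≡⟨ ℤP.neg-distribˡ-* x _ ⟨
  - oddProd k x
    ∎
  where
  neg-square : ∀ x → - x * - x ≡ x * x
  neg-square = solve-∀

-- The Legendre–Stirling polynomial

eval : Poly → ℤ → ℤ
eval []      y = + 0
eval (a ∷ p) y = a + y * eval p y

eval-addP : ∀ p q y → eval (addP p q) y ≡ eval p y + eval q y
eval-addP []      q       y = sym (ℤP.+-identityˡ _)
eval-addP (a ∷ p) []      y = sym (ℤP.+-identityʳ _)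
eval-addP (a ∷ p) (b ∷ q) y = trans (cong (λ z → a + b + y * z) (eval-addP p q y)) (regroup a b y (eval p y) (eval q y))
  where
  regroup : ∀ a b y u v → a + b + y * (u + v) ≡ a + y * u + (b + y * v)
  regroup = solve-∀

eval-scale : ∀ c p y → eval (scale c p) y ≡ c * eval p y
eval-scale c []      y = sym (ℤP.*-zeroʳ c)
eval-scale c (a ∷ p) y = trans (cong (λ z → c * a + y * z) (eval-scale c p y)) (regroup c a y (eval p y))
  where
  regroup : ∀ c a y u → c * a + y * (c * u) ≡ c * (a + y * u)
  regroup = solve-∀

eval-mulLin : ∀ c p y → eval (mulLin c p) y ≡ (y - c) * eval p y
eval-mulLin c p y = begin
  eval (addP (+ 0 ∷ p) (scale (- c) p)) y ≡⟨ eval-addP (+ 0 ∷ p) (scale (- c) p) y ⟩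
  + 0 + y * eval p y + eval (scale (- c) p) y ≡⟨ cong (_+_ (+ 0 + y * eval p y)) (eval-scale (- c) p y) ⟩
  + 0 + y * eval p y + - c * eval p y ≡⟨ regroup y c (eval p y) ⟩
  (y - c) * eval p y ∎
  where
  regroup : ∀ y c u → + 0 + y * u + - c * u ≡ (y - c) * u
  regroup = solve-∀

eval-psPoly : ∀ k y → eval (psPoly k) y ≡ prodℤ k (λ r → y - + r * (+ r + + 1))
eval-psPoly zero    y = base y
  where
  base : ∀ y → + 1 + y * + 0 ≡ + 1
  base = solve-∀
eval-psPoly (suc k) y = begin
  eval (mulLin (+ (k ℕ.* suc k)) (psPoly k)) y
    ≡⟨ eval-mulLin _ (psPoly k) y ⟩
  (y - + (k ℕ.* suc k)) * eval (psPoly k) y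
    ≡⟨ cong₂ (λ c e → (y - c) * e) (ℤP.pos-* k (suc k)) (eval-psPoly k y) ⟩
  (y - + k * + suc k) * prodℤ k (λ r → y - + r * (+ r + + 1))
    ≡⟨ commute y (+ k) _ ⟩
  prodℤ k (λ r → y - + r * (+ r + + 1)) * (y - + k * (+ k + + 1))
    ∎
  where
  commute : ∀ y k P → (y - k * (+ 1 + k)) * P ≡ P * (y - k * (k + + 1))
  commute = solve-∀

length-mulLin : ∀ c p → length (mulLin c p) ≡ suc (length p)
length-mulLin c p = go (+ 0) p
  where
  go : ∀ a p → length (addP (a ∷ p) (scale (- c) p)) ≡ suc (length p)
  go a []      = refl
  go a (b ∷ p) = cong suc (go b p)

length-psPoly : ∀ k → length (psPoly k) ≡ suc k
length-psPoly zero    = refl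
length-psPoly (suc k) = trans (length-mulLin _ (psPoly k)) (cong suc (length-psPoly k))

eval≡sumℤ-coeff : ∀ p n y → length p ≤ n → eval p y ≡ sumℤ n (λ r → coeff p r * y ^ r)
eval≡sumℤ-coeff []      n       y _             = sym (sumℤ-zero n (λ _ _ → refl))
eval≡sumℤ-coeff (a ∷ p) (suc n) y (s≤s len≤n) = begin
  a + y * eval p y
    ≡⟨ cong₂ _+_ (sym (ℤP.*-identityʳ a)) (cong (y *_) (eval≡sumℤ-coeff p n y len≤n)) ⟩
  a * + 1 + y * sumℤ n (λ r → coeff p r * y ^ r)
    ≡⟨ cong (_+_ (a * + 1)) (*-distribˡ-sumℤ n y _) ⟩
  a * + 1 + sumℤ n (λ r → y * (coeff p r * y ^ r))
    ≡⟨ cong (_+_ (a * + 1)) (sumℤ-cong n (λ r _ → *-left-comm y (coeff p r) (y ^ r))) ⟩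
  a * + 1 + sumℤ n (λ r → coeff p r * (y * y ^ r))
    ≡⟨ sumℤ-head n _ ⟨
  sumℤ (suc n) (λ r → coeff (a ∷ p) r * y ^ r)
    ∎

sumPs≡prod : ∀ k y → sumℤ (suc k) (λ r → Ps k r * y ^ r) ≡ prodℤ k (λ r → y - + r * (+ r + + 1))
sumPs≡prod k y =
  trans (sym (eval≡sumℤ-coeff (psPoly k) (suc k) y (ℕP.≤-reflexive (length-psPoly k)))) (eval-psPoly k y)

-- Binomial coefficients with integer lower index

binomℤ : ℕ → ℤ → ℤ
binomℤ n (+ k)    = + (n C k)
binomℤ n -[1+ _ ] = + 0

binomℤ-pascal : ∀ n j → binomℤ (suc n) j ≡ binomℤ n (j - + 1) + binomℤ n j
binomℤ-pascal n (+ zero)  = refl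
binomℤ-pascal n (+ suc k) = pos-pascal n k
binomℤ-pascal n -[1+ k ]  = refl

binomLow≡binomℤ : ∀ i r → binomLow i r ≡ binomℤ i (+ 2 * (+ i - + r))
binomLow≡binomℤ i r with r ≤ᵇ i | ℕP.≤ᵇ-reflects-≤ r i
... | true  | ofʸ r≤i = cong (binomℤ i) (begin
  + (2 ℕ.* (i ∸ r)) ≡⟨ ℤP.pos-* 2 (i ∸ r) ⟩
  + 2 * + (i ∸ r)   ≡⟨ cong (+ 2 *_) (trans (ℤP.m-n≡m⊖n i r) (ℤP.⊖-≥ r≤i)) ⟨
  + 2 * (+ i - + r) ∎)
... | false | ofⁿ r≰i = sym (begin
  binomℤ i (+ 2 * (+ i - + r))   ≡⟨ cong (λ j → binomℤ i (+ 2 * j)) (trans (ℤP.m-n≡m⊖n i r) (ℤP.⊖-< i<r)) ⟩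
  binomℤ i (+ 2 * - + (r ∸ i))   ≡⟨ twice-negative (r ∸ i) (ℕP.m<n⇒0<n∸m i<r) ⟩
  + 0                            ∎)
  where
  i<r : i < r
  i<r = ℕP.≰⇒> r≰i
  twice-negative : ∀ d → 0 < d → binomℤ i (+ 2 * - + d) ≡ + 0
  twice-negative (suc d) _ = refl

binomLow-vanish : ∀ i r → i < r → binomLow i r ≡ + 0
binomLow-vanish i r i<r with r ≤ᵇ i | ℕP.≤ᵇ-reflects-≤ r i
... | true  | ofʸ r≤i = contradiction r≤i (ℕP.<⇒≱ i<r)
... | false | _       = refl

binomLow-suc-zero : ∀ i → binomLow (suc i) 0 ≡ + 0
binomLow-suc-zero i = cong +_ (k>n⇒nCk≡0 (ℕP.m<m+n (suc i) z<s))

-- binomLow i r and oddCoeff i r are the coefficients of x^{2r} and x^{2r+1} in (x² + x)^i.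
oddCoeff : ℕ → ℕ → ℤ
oddCoeff i r = binomℤ i (+ 2 * (+ i - + r) - + 1)

oddCoeff-zero : ∀ r → oddCoeff 0 r ≡ + 0
oddCoeff-zero zero    = refl
oddCoeff-zero (suc r) = refl

binomLow-pascal : ∀ i r → binomLow (suc i) (suc r) ≡ oddCoeff i r + binomLow i r
binomLow-pascal i r = begin
  binomLow (suc i) (suc r)                     ≡⟨ binomLow≡binomℤ (suc i) (suc r) ⟩
  binomℤ (suc i) (+ 2 * (+ suc i - + suc r))  ≡⟨ cong (binomℤ (suc i)) (shift (+ i) (+ r)) ⟩
  binomℤ (suc i) (+ 2 * (+ i - + r))          ≡⟨ binomℤ-pascal i _ ⟩
  oddCoeff i r + binomℤ i (+ 2 * (+ i - + r)) ≡⟨ cong (_+_ (oddCoeff i r)) (binomLow≡binomℤ i r) ⟨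
  oddCoeff i r + binomLow i r                  ∎
  where
  shift : ∀ i r → + 2 * ((+ 1 + i) - (+ 1 + r)) ≡ + 2 * (i - r)
  shift = solve-∀

oddCoeff-pascal : ∀ i r → oddCoeff (suc i) (suc r) ≡ binomLow i (suc r) + oddCoeff i r
oddCoeff-pascal i r = begin
  binomℤ (suc i) (+ 2 * (+ suc i - + suc r) - + 1)
    ≡⟨ cong (binomℤ (suc i)) (shift (+ i) (+ r)) ⟩
  binomℤ (suc i) (+ 2 * (+ i - + r) - + 1)
    ≡⟨ binomℤ-pascal i _ ⟩
  binomℤ i (+ 2 * (+ i - + r) - + 1 - + 1) + oddCoeff i r
    ≡⟨ cong (λ j → binomℤ i j + oddCoeff i r) (lower (+ i) (+ r)) ⟩
  binomℤ i (+ 2 * (+ i - + suc r)) + oddCoeff i r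
    ≡⟨ cong (_+ oddCoeff i r) (binomLow≡binomℤ i (suc r)) ⟨
  binomLow i (suc r) + oddCoeff i r
    ∎
  where
  shift : ∀ i r → + 2 * ((+ 1 + i) - (+ 1 + r)) - + 1 ≡ + 2 * (i - r) - + 1
  shift = solve-∀
  lower : ∀ i r → + 2 * (i - r) - + 1 - + 1 ≡ + 2 * (i - (+ 1 + r))
  lower = solve-∀

oddCoeff-suc-zero : ∀ i → oddCoeff (suc i) 0 ≡ binomLow i 0
oddCoeff-suc-zero i = begin
  binomℤ (suc i) (+ 2 * (+ suc i - + 0) - + 1)
    ≡⟨ cong (binomℤ (suc i)) top ⟨
  + (suc i C suc (2 ℕ.* i))
    ≡⟨ pos-pascal i (2 ℕ.* i) ⟩
  + (i C (2 ℕ.* i)) + + (i C suc (2 ℕ.* i))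
    ≡⟨ cong (λ c → + (i C (2 ℕ.* i)) + + c) (k>n⇒nCk≡0 (s≤s (ℕP.m≤m+n i _))) ⟩
  + (i C (2 ℕ.* i)) + + 0
    ≡⟨ ℤP.+-identityʳ _ ⟩
  binomLow i 0
    ∎
  where
  index : ∀ i → + 1 + + 2 * i ≡ + 2 * ((+ 1 + i) - + 0) - + 1
  index = solve-∀
  top : + suc (2 ℕ.* i) ≡ + 2 * (+ suc i - + 0) - + 1
  top = trans (cong (_+_ (+ 1)) (ℤP.pos-* 2 i)) (index (+ i))

-- Even and odd parts of (x² + x)^i

evenPart : ℕ → ℕ → ℤ → ℤ
evenPart N i x = sumℤ N (λ r → binomLow i r * (x * x) ^ r)

oddPart : ℕ → ℕ → ℤ → ℤ
oddPart N i x = sumℤ N (λ r → oddCoeff i r * (x * (x * x) ^ r))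

evenPart-zero : ∀ N x → evenPart (suc N) 0 x ≡ + 1
evenPart-zero N x = trans (sumℤ-head N _) (cong (_+_ (+ 1)) (sumℤ-zero N (λ _ _ → refl)))

oddPart-zero : ∀ N x → oddPart N 0 x ≡ + 0
oddPart-zero N x = sumℤ-zero N (λ r _ → cong (_* (x * (x * x) ^ r)) (oddCoeff-zero r))

evenPart-extend : ∀ N i x → i < N → evenPart (suc N) i x ≡ evenPart N i x
evenPart-extend N i x i<N =
  trans (cong (λ b → evenPart N i x + b * (x * x) ^ N) (binomLow-vanish i N i<N)) (ℤP.+-identityʳ _)

evenPart-suc : ∀ N i x → evenPart (suc N) (suc i) x ≡ x * oddPart N i x + x * x * evenPart N i x
evenPart-suc N i x = begin
  evenPart (suc N) (suc i) x
    ≡⟨ sumℤ-head N _ ⟩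
  binomLow (suc i) 0 * + 1 + sumℤ N (λ r → binomLow (suc i) (suc r) * (x * x) ^ suc r)
    ≡⟨ cong₂ _+_ (cong (_* + 1) (binomLow-suc-zero i)) (sumℤ-cong N (λ r _ →
         trans (cong (_* (x * x) ^ suc r) (binomLow-pascal i r)) (split (oddCoeff i r) (binomLow i r) x ((x * x) ^ r)))) ⟩
  + 0 + sumℤ N (λ r → x * (oddCoeff i r * (x * (x * x) ^ r)) + x * x * (binomLow i r * (x * x) ^ r))
    ≡⟨ trans (ℤP.+-identityˡ _) (sumℤ-linear N x (x * x) _ _) ⟩
  x * oddPart N i x + x * x * evenPart N i x
    ∎
  where
  split : ∀ o e x X → (o + e) * (x * x * X) ≡ x * (o * (x * X)) + x * x * (e * X)
  split = solve-∀

oddPart-suc : ∀ N i x → i < N → oddPart (suc N) (suc i) x ≡ x * evenPart N i x + x * x * oddPart N i x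
oddPart-suc N i x i<N = begin
  oddPart (suc N) (suc i) x
    ≡⟨ sumℤ-head N _ ⟩
  oddCoeff (suc i) 0 * (x * + 1) + sumℤ N (λ r → oddCoeff (suc i) (suc r) * (x * (x * x) ^ suc r))
    ≡⟨ cong₂ _+_ (cong (_* (x * + 1)) (oddCoeff-suc-zero i)) (sumℤ-cong N (λ r _ →
         trans (cong (_* (x * (x * x) ^ suc r)) (oddCoeff-pascal i r))
               (split (binomLow i (suc r)) (oddCoeff i r) x ((x * x) ^ r)))) ⟩
  binomLow i 0 * (x * + 1) + sumℤ N (λ r → x * (binomLow i (suc r) * (x * x) ^ suc r) + x * x * (oddCoeff i r * (x * (x * x) ^ r)))
    ≡⟨ cong (_+_ (binomLow i 0 * (x * + 1))) (sumℤ-linear N x (x * x) _ _) ⟩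
  binomLow i 0 * (x * + 1) + (x * sumℤ N (λ r → binomLow i (suc r) * (x * x) ^ suc r) + x * x * oddPart N i x)
    ≡⟨ regroup (binomLow i 0) x _ _ ⟩
  x * (binomLow i 0 * + 1 + sumℤ N (λ r → binomLow i (suc r) * (x * x) ^ suc r)) + x * x * oddPart N i x
    ≡⟨ cong (λ e → x * e + x * x * oddPart N i x) (trans (sym (sumℤ-head N _)) (evenPart-extend N i x i<N)) ⟩
  x * evenPart N i x + x * x * oddPart N i x
    ∎
  where
  split : ∀ e o x X → (e + o) * (x * (x * x * X)) ≡ x * (e * (x * x * X)) + x * x * (o * (x * X))
  split = solve-∀
  regroup : ∀ b x s t → b * (x * + 1) + (x * s + t) ≡ x * (b * + 1 + s) + t
  regroup = solve-∀

evenPart±oddPart : ∀ N i x → i < N →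
                   (evenPart N i x + oddPart N i x ≡ (x * (x + + 1)) ^ i)
                 × (evenPart N i x - oddPart N i x ≡ (- x * (- x + + 1)) ^ i)
evenPart±oddPart (suc N) zero x _ =
  cong₂ _+_ (evenPart-zero N x) (oddPart-zero (suc N) x) , cong₂ _-_ (evenPart-zero N x) (oddPart-zero (suc N) x)
evenPart±oddPart (suc N) (suc i) x (s≤s i<N) with evenPart±oddPart N i x i<N
... | sum≡ , difference≡ =
    trans (cong₂ _+_ E′ O′) (trans (plus e o x) (cong (x * (x + + 1) *_) sum≡))
  , trans (cong₂ _-_ E′ O′) (trans (minus e o x) (cong (- x * (- x + + 1) *_) difference≡))
  where
  e o : ℤ
  e = evenPart N i x
  o = oddPart N i x
  E′ : evenPart (suc N) (suc i) x ≡ x * o + x * x * e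
  E′ = evenPart-suc N i x
  O′ : oddPart (suc N) (suc i) x ≡ x * e + x * x * o
  O′ = oddPart-suc N i x i<N
  plus : ∀ e o x → x * o + x * x * e + (x * e + x * x * o) ≡ x * (x + + 1) * (e + o)
  plus = solve-∀
  minus : ∀ e o x → x * o + x * x * e - (x * e + x * x * o) ≡ - x * (- x + + 1) * (e - o)
  minus = solve-∀

twice-evenPart : ∀ N i x → i < N → + 2 * evenPart N i x ≡ (x * (x + + 1)) ^ i + (- x * (- x + + 1)) ^ i
twice-evenPart N i x i<N with evenPart±oddPart N i x i<N
... | sum≡ , difference≡ = trans (double (evenPart N i x) (oddPart N i x)) (cong₂ _+_ sum≡ difference≡)
  where
  double : ∀ e o → + 2 * e ≡ (e + o) + (e - o)
  double = solve-∀

-- The numbers 𝒮_k^(r)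

sum𝒮 : ℕ → ℤ → ℤ
sum𝒮 k x = sumℤ (suc k) (λ r → 𝒮 k r * (x * x) ^ r)

oddSum : ℕ → ℤ → ℤ
oddSum k x = sumℤ k (λ i → 𝒮 k (suc i) * x ^ (2 ℕ.* suc i ∸ 1))

sum𝒮≡sumPs*evenPart : ∀ k x → sum𝒮 k x ≡ sumℤ (suc k) (λ i → Ps k i * evenPart (suc k) i x)
sum𝒮≡sumPs*evenPart k x = begin
  sumℤ (suc k) (λ r → 𝒮 k r * (x * x) ^ r)
    ≡⟨ sumℤ-cong (suc k) (λ r _ → *-distribʳ-sumℤ (suc k) ((x * x) ^ r) _) ⟩
  sumℤ (suc k) (λ r → sumℤ (suc k) (λ i → binomLow i r * Ps k i * (x * x) ^ r))
    ≡⟨ sumℤ-comm (suc k) (suc k) _ ⟩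
  sumℤ (suc k) (λ i → sumℤ (suc k) (λ r → binomLow i r * Ps k i * (x * x) ^ r))
    ≡⟨ sumℤ-cong (suc k) (λ i _ → trans (sumℤ-cong (suc k) (λ r _ → reorder (binomLow i r) (Ps k i) ((x * x) ^ r)))
                                       (sym (*-distribˡ-sumℤ (suc k) (Ps k i) _))) ⟩
  sumℤ (suc k) (λ i → Ps k i * evenPart (suc k) i x)
    ∎
  where
  reorder : ∀ b p X → b * p * X ≡ p * (b * X)
  reorder = solve-∀

twice-sum𝒮 : ∀ k x → + 2 * sum𝒮 k x ≡ evenProd k x + evenProd k (- x)
twice-sum𝒮 k x = begin
  + 2 * sum𝒮 k x
    ≡⟨ cong (+ 2 *_) (sum𝒮≡sumPs*evenPart k x) ⟩
  + 2 * sumℤ (suc k) (λ i → Ps k i * evenPart (suc k) i x)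
    ≡⟨ *-distribˡ-sumℤ (suc k) (+ 2) _ ⟩
  sumℤ (suc k) (λ i → + 2 * (Ps k i * evenPart (suc k) i x))
    ≡⟨ sumℤ-cong (suc k) (λ i i≤k →
         trans (*-left-comm (+ 2) (Ps k i) _) (cong (Ps k i *_) (twice-evenPart (suc k) i x i≤k))) ⟩
  sumℤ (suc k) (λ i → Ps k i * ((x * (x + + 1)) ^ i + (- x * (- x + + 1)) ^ i))
    ≡⟨ trans (sumℤ-cong (suc k) (λ i _ → ℤP.*-distribˡ-+ (Ps k i) _ _)) (sumℤ-distrib-+ (suc k) _ _) ⟩
  sumℤ (suc k) (λ i → Ps k i * (x * (x + + 1)) ^ i) + sumℤ (suc k) (λ i → Ps k i * (- x * (- x + + 1)) ^ i)
    ≡⟨ cong₂ _+_ (sumPs≡prod k _) (sumPs≡prod k _) ⟩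
  evenProd k x + evenProd k (- x)
    ∎

sum𝒮-suc : ∀ k x → sum𝒮 (suc k) x ≡ x * oddProd k x
sum𝒮-suc k x = ℤP.*-cancelˡ-≡ (+ 2) _ _ (begin
  + 2 * sum𝒮 (suc k) x
    ≡⟨ twice-sum𝒮 (suc k) x ⟩
  evenProd (suc k) x + evenProd (suc k) (- x)
    ≡⟨ cong₂ _+_ (evenProd-suc k x) (evenProd-suc k (- x)) ⟩
  (x + + suc k) * oddProd k x + (- x + + suc k) * oddProd k (- x)
    ≡⟨ cong (λ q → (x + + suc k) * oddProd k x + (- x + + suc k) * q) (oddProd-neg k x) ⟩
  (x + + suc k) * oddProd k x + (- x + + suc k) * - oddProd k x
    ≡⟨ collect x (+ k) (oddProd k x) ⟩
  + 2 * (x * oddProd k x)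
    ∎)
  where
  collect : ∀ x k q → (x + (+ 1 + k)) * q + (- x + (+ 1 + k)) * - q ≡ + 2 * (x * q)
  collect = solve-∀

sum𝒮-split : ∀ k x → sum𝒮 k x ≡ 𝒮 k 0 + x * oddSum k x
sum𝒮-split k x = begin
  sum𝒮 k x
    ≡⟨ sumℤ-head k _ ⟩
  𝒮 k 0 * + 1 + sumℤ k (λ i → 𝒮 k (suc i) * (x * x) ^ suc i)
    ≡⟨ cong₂ _+_ (ℤP.*-identityʳ (𝒮 k 0)) (sumℤ-cong k (λ i _ →
         trans (cong (𝒮 k (suc i) *_) (square-^ x (suc i))) (*-left-comm (𝒮 k (suc i)) x _))) ⟩
  𝒮 k 0 + sumℤ k (λ i → x * (𝒮 k (suc i) * x ^ (2 ℕ.* suc i ∸ 1)))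
    ≡⟨ cong (_+_ (𝒮 k 0)) (*-distribˡ-sumℤ k x _) ⟨
  𝒮 k 0 + x * oddSum k x
    ∎
  where
  square-^ : ∀ x n → (x * x) ^ n ≡ x ^ (2 ℕ.* n)
  square-^ x n = trans (cong (λ y → (x * y) ^ n) (sym (ℤP.*-identityʳ x))) (ℤP.^-*-assoc x 2 n)

𝒮-suc-zero : ∀ k → 𝒮 (suc k) 0 ≡ + 0
𝒮-suc-zero k = trans (sym (ℤP.+-identityʳ _)) (trans (sym (sum𝒮-split (suc k) (+ 0))) (sum𝒮-suc k (+ 0)))

oddSum≡oddProd : ∀ k x → oddSum (suc k) x ≡ oddProd k x
oddSum≡oddProd k x = cancel x (begin
  x * oddSum (suc k) x             ≡⟨ ℤP.+-identityˡ _ ⟨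
  + 0 + x * oddSum (suc k) x       ≡⟨ cong (_+ x * oddSum (suc k) x) (𝒮-suc-zero k) ⟨
  𝒮 (suc k) 0 + x * oddSum (suc k) x ≡⟨ sum𝒮-split (suc k) x ⟨
  sum𝒮 (suc k) x                   ≡⟨ sum𝒮-suc k x ⟩
  x * oddProd k x                  ∎)
  where
  cancel : ∀ x → x * oddSum (suc k) x ≡ x * oddProd k x → oddSum (suc k) x ≡ oddProd k x
  cancel (+ zero)     _  = sumℤ-zero (suc k) (λ i _ →
    trans (cong (λ n → 𝒮 (suc k) (suc i) * (+ 0) ^ n) (2*[1+n]∸1≡1+2*n i)) (ℤP.*-zeroʳ (𝒮 (suc k) (suc i))))
  cancel x@(+[1+ _ ]) eq = ℤP.*-cancelˡ-≡ x _ _ eq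
  cancel x@(-[1+ _ ]) eq = ℤP.*-cancelˡ-≡ x _ _ eq

lemma5p1 :
  (∀ (k m : ℕ) →
      (+ ((2 Data.Nat.* k) !) * + ((m Data.Nat.+ k) C (2 Data.Nat.* k))
        ≡ prodℤ k (λ r → + m * (+ m + + 1) - + r * (+ r + + 1)))
    × (prodℤ k (λ r → + m * (+ m + + 1) - + r * (+ r + + 1))
        ≡ falling (+ m + + k) (2 Data.Nat.* k))
    × (falling (+ m + + k) (2 Data.Nat.* k)
        ≡ sumℤ (suc k) (λ r → Ps k r * (+ m * (+ m + + 1)) ^ r)))
  × (∀ (k m : ℕ) → 1 ≤ k →
      (+ ((2 Data.Nat.* k ∸ 1) !) * + ((m Data.Nat.+ k ∸ 1) C (2 Data.Nat.* k ∸ 1))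
        ≡ + m * prodℤ (k ∸ 1) (λ t → + m * + m - + (suc t) * + (suc t)))
    × (+ m * prodℤ (k ∸ 1) (λ t → + m * + m - + (suc t) * + (suc t))
        ≡ falling (+ m + + k - + 1) (2 Data.Nat.* k ∸ 1))
    × (falling (+ m + + k - + 1) (2 Data.Nat.* k ∸ 1)
        ≡ sumℤ k (λ i → 𝒮 k (suc i) * (+ m) ^ (2 Data.Nat.* suc i ∸ 1))))
lemma5p1 =
    (λ k m → !*C≡evenProd k m
           , evenProd≡falling k (+ m)
           , trans (sym (evenProd≡falling k (+ m))) (sym (sumPs≡prod k (+ m * (+ m + + 1)))))
  , λ { (suc k) m _ → !*C≡oddProd k m
                    , oddProd≡falling′ k (+ m)
                    , trans (sym (oddProd≡falling′ k (+ m))) (sym (oddSum≡oddProd k (+ m))) }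
  where
  oddProd≡falling′ : ∀ k x → oddProd k x ≡ falling (x + + suc k - + 1) (2 ℕ.* suc k ∸ 1)
  oddProd≡falling′ k x = trans (oddProd≡falling k x) (cong₂ falling (shift x (+ k)) (sym (2*[1+n]∸1≡1+2*n k)))
    where
    shift : ∀ x k → x + k ≡ x + (+ 1 + k) - + 1
    shift = solve-∀
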